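{- For any fixed $\delta>0$ and any sequence $(L_n)$ of Latin squares of order $n$ with entries in $[n]$, with probability tending to $1$ as $n\to\infty$ the random graph $G\in\mathscr{G}(L_n,(1+\delta)\log_2 n)$ is connected.
   Context: A Latin square of order $n$ is an $n\times n$ matrix with entries from a set of $n$ elements such that each element appears exactly once in each row and each column. Given a Latin square $L$ with entries in $[n]$ and a (multi)set $S$ of elements of $[n]$, the Latin square graph $G(L,S)$ is the simple graph on $[n]$ in which distinct $i,j$ are adjacent iff $L_{ij}\in S$ or $L_{ji}\in S$. The model $\mathscr{G}(L_n,k)$ is $G(L_n,S)$ where $S$ is a multiset of $k$ elements of $[n]$ chosen independently and uniformly at random with replacement.
   Formalization: The parameter δ ranges over the positive rationals. -}

module Defs where

open import Data.Nat using (ℕ; zero; suc; _*_; _^_; _≤_)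
open import Data.Fin using (Fin)
open import Data.Vec using (Vec; lookup)
open import Data.List using (List; length)
open import Data.List.Relation.Unary.All using (All)
open import Data.List.Relation.Unary.Unique.Propositional using (Unique)
open import Data.Product using (Σ; ∃; _×_; _,_)
open import Data.Sum using (_⊎_)
open import Relation.Nullary using (¬_)
open import Relation.Binary.PropositionalEquality using (_≡_)
open import Function.Definitions using (Bijective)

record LatinSquare (n : ℕ) : Set where
  field
    entry  : Fin n → Fin n → Fin n
    rowBij : ∀ i → Bijective _≡_ _≡_ (λ j → entry i j)
    colBij : ∀ j → Bijective _≡_ _≡_ (λ i → entry i j)

open LatinSquare public

_∈S_ : ∀ {n k} → Fin n → Vec (Fin n) k → Set
x ∈S S = ∃ λ t → lookup S t ≡ x

Adj : ∀ {n k} → LatinSquare n → Vec (Fin n) k → Fin n → Fin n → Set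
Adj L S i j = ¬ (i ≡ j) × ((entry L i j ∈S S) ⊎ (entry L j i ∈S S))

data Reach {n k} (L : LatinSquare n) (S : Vec (Fin n) k) (i : Fin n) : Fin n → Set where
  here : Reach L S i i
  step : ∀ {j l} → Reach L S i j → Adj L S j l → Reach L S i l

Connected : ∀ {n k} → LatinSquare n → Vec (Fin n) k → Set
Connected L S = ∀ i j → Reach L S i j

-- "P holds with probability at least 1 - 1/(m+1)" for S uniform in [n]^k
-- (k independent uniform choices with replacement): the number of
-- sequences S satisfying P, witnessed by a duplicate-free list of them,
-- is at least (1 - 1/(m+1)) * n^k.
ProbAtLeast : (n k m : ℕ) → (Vec (Fin n) k → Set) → Set
ProbAtLeast n k m P =
  Σ (List (Vec (Fin n) k)) λ xs → Unique xs × All P xs × (m * n ^ k ≤ suc m * length xs)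

-- Let c(S) be the number of components of G(L, S), read off as the roots of a union–find
-- representative map. One more random symbol halves the excess c − 1 on average:
-- 2 ∑ₛ c(s S) ≤ n c(S) + n. A component of G(L, S) that is not closed under the permutation
-- "column of s in row i" merges with another one, while a symbol s closing the component with
-- root z is determined by the cell (z, column s z) of that component, so summed over all s at
-- most n components stay closed. Hence ∑_{S ∈ [n]^k} (c(S) − 1) ≤ n^(k+1) / 2^k, i.e. G(L, S)
-- is disconnected for at most a fraction n / 2^k of the S, which is below 1/(m+1) for large n.

module Submission where

open import Defs
open import Data.Bool.Base using (if_then_else_)
open import Data.Nat using (ℕ; zero; suc; _+_; _*_; _^_; _≤_; _<_; pred; z≤n; s≤s; >-nonZero)
import Data.Nat as ℕ
open import Data.Nat.Properties hiding (_≟_)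
open import Data.Nat.ListAction using () renaming (sum to sumˡ)
open import Data.Nat.ListAction.Properties using (sum-++)
open import Data.Nat.Tactic.RingSolver using (solve-∀)
open import Data.Fin using (Fin; _≟_)
import Data.Fin as Fin
open import Data.Fin.Properties using (all?; ¬∀⟶∃¬)
open import Data.Vec using (Vec; []; _∷_)
open import Data.List using (List; []; _∷_; [_]; _++_; map; filter; length; tabulate; allFin; cartesianProductWith)
open import Data.List.Properties using (map-++; map-∘; map-cong)
open import Data.List.Membership.Propositional using (_∈_)
open import Data.List.Membership.Propositional.Properties using (∈-allFin)
open import Data.List.Relation.Unary.Any using (here; there)
open import Data.List.Relation.Unary.All as All using ()
open import Data.List.Relation.Unary.All.Properties using (all-filter)
open import Data.List.Relation.Unary.AllPairs using ([]; _∷_)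
open import Data.List.Relation.Unary.Unique.Propositional using (Unique)
open import Data.List.Relation.Unary.Unique.Propositional.Properties using (cartesianProductWith⁺; allFin⁺; filter⁺)
open import Data.Product using (∃; _×_; _,_; proj₁; proj₂; map₁)
open import Data.Sum using (inj₁; inj₂)
open import Function using (id; _∘_)
open import Level using (Level; 0ℓ)
open import Relation.Nullary using (¬_; Dec; does; yes; no; ¬?; _×-dec_; _→-dec_; contradiction)
open import Relation.Nullary.Decidable using (decidable-stable)
open import Relation.Unary using (Pred; Decidable; _⊆_; _∩_; ∁)
open import Relation.Unary.Properties using (_∩?_; ∁?; U?)
open import Relation.Binary using (Rel; IsEquivalence)
open import Relation.Binary.PropositionalEquality using (_≡_; refl; sym; trans; cong; cong₂; subst; module ≡-Reasoning)
open import Algebra.Properties.Semiring.Sum +-*-semiring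
  using (sum; sum-syntax; ∑-comm; ∑-distrib-+; *-distribˡ-sum; sum-remove; sum-replicate-zero; sum-cong-≗)
open import Algebra.Properties.CommutativeSemigroup *-commutativeSemigroup using (x∙yz≈y∙xz; xy∙z≈y∙xz)

private variable
  p q ℓ : Level
  m n : ℕ
  A B C : Set

complement-bound : ∀ m {N G B} → G + B ≡ N → suc m * B ≤ N → m * N ≤ suc m * G
complement-bound m {N} {G} {B} G+B≡N bad≤ = +-cancelʳ-≤ (suc m * B) (m * N) (suc m * G) (begin
  m * N + suc m * B     ≤⟨ +-monoʳ-≤ (m * N) bad≤ ⟩
  m * N + N             ≡⟨ +-comm (m * N) N ⟩
  suc m * N             ≡⟨ cong (suc m *_) G+B≡N ⟨
  suc m * (G + B)       ≡⟨ *-distribˡ-+ (suc m) G B ⟩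
  suc m * G + suc m * B ∎)
  where open ≤-Reasoning

^-distrib-* : ∀ x y e → (x * y) ^ e ≡ x ^ e * y ^ e
^-distrib-* x y zero    = refl
^-distrib-* x y (suc e) = trans (cong (x * y *_) (^-distrib-* x y e)) ([m*n]*[o*p]≡[m*o]*[n*p] x y (x ^ e) (y ^ e))

m≤m^[1+n] : ∀ m n → m ≤ m ^ suc n
m≤m^[1+n] zero    n = z≤n
m≤m^[1+n] (suc m) n = ≤-trans (≤-reflexive (sym (*-identityʳ (suc m)))) (*-monoʳ-≤ (suc m) (m^n>0 (suc m) n))

∑-mono-≤ : {f g : Fin n → ℕ} → (∀ i → f i ≤ g i) → sum f ≤ sum g
∑-mono-≤ {zero}  _   = z≤n
∑-mono-≤ {suc n} f≤g = +-mono-≤ (f≤g Fin.zero) (∑-mono-≤ (f≤g ∘ Fin.suc))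

∑-const : ∀ n c → ∑[ i < n ] c ≡ n * c
∑-const zero    c = refl
∑-const (suc n) c = cong (c +_) (∑-const n c)

≤-∑ : (f : Fin n → ℕ) (i : Fin n) → f i ≤ sum f
≤-∑ {suc n} f i = ≤-trans (m≤m+n (f i) _) (≤-reflexive (sym (sum-remove f)))

𝟙 : {P : Set p} → Dec P → ℕ
𝟙 d = if does d then 1 else 0

𝟙-yes : {P : Set p} (d : Dec P) → P → 𝟙 d ≡ 1
𝟙-yes (yes _) _  = refl
𝟙-yes (no ¬p) p = contradiction p ¬p

𝟙≤1 : {P : Set p} (d : Dec P) → 𝟙 d ≤ 1
𝟙≤1 (yes _) = s≤s z≤n
𝟙≤1 (no _)  = z≤n

𝟙-mono : {P : Set p} {Q : Set q} → (P → Q) → (d : Dec P) (e : Dec Q) → 𝟙 d ≤ 𝟙 e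
𝟙-mono P→Q (yes p) e      = ≤-reflexive (sym (𝟙-yes e (P→Q p)))
𝟙-mono P→Q (no _)  e      = z≤n

𝟙-split : {P : Set p} {Q : Set q} (d : Dec P) (e : Dec Q) → 𝟙 d ≡ 𝟙 (d ×-dec e) + 𝟙 (d ×-dec ¬? e)
𝟙-split (yes _) (yes _) = refl
𝟙-split (yes _) (no _)  = refl
𝟙-split (no _)  _       = refl

𝟙+𝟙¬ : {P : Set p} (d : Dec P) → 𝟙 d + 𝟙 (¬? d) ≡ 1
𝟙+𝟙¬ (yes _) = refl
𝟙+𝟙¬ (no _)  = refl

∑-δ : (a : Fin n) → ∑[ x < n ] 𝟙 (a ≟ x) ≡ 1
∑-δ {suc n} Fin.zero    = cong suc (sum-replicate-zero n)
∑-δ {suc n} (Fin.suc a) = ∑-δ a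

count : {P : Pred (Fin n) p} → Decidable P → ℕ
count {n = n} P? = ∑[ x < n ] 𝟙 (P? x)

module _ {P : Pred (Fin n) p} (P? : Decidable P) where

  count≤n : count P? ≤ n
  count≤n = ≤-trans (∑-mono-≤ (𝟙≤1 ∘ P?)) (≤-reflexive (trans (∑-const n 1) (*-identityʳ n)))

  witness⇒1≤count : {x : Fin n} → P x → 1 ≤ count P?
  witness⇒1≤count {x} px = ≤-trans (≤-reflexive (sym (𝟙-yes (P? x) px))) (≤-∑ (𝟙 ∘ P?) x)

  count-mono : {Q : Pred (Fin n) q} (Q? : Decidable Q) → P ⊆ Q → count P? ≤ count Q?
  count-mono Q? P⊆Q = ∑-mono-≤ (λ x → 𝟙-mono P⊆Q (P? x) (Q? x))

  count-split : {Q : Pred (Fin n) q} (Q? : Decidable Q) → count P? ≡ count (P? ∩? Q?) + count (P? ∩? ∁? Q?)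
  count-split Q? = trans (sum-cong-≗ (λ x → 𝟙-split (P? x) (Q? x))) (∑-distrib-+ (𝟙 ∘ (P? ∩? Q?)) (𝟙 ∘ (P? ∩? ∁? Q?)))

distinct⇒2≤count : {P : Pred (Fin n) p} (P? : Decidable P) {x y : Fin n} → P x → P y → ¬ x ≡ y → 2 ≤ count P?
distinct⇒2≤count P? {x} px py x≢y = ≤-trans
  (+-mono-≤ (witness⇒1≤count (P? ∩? (_≟ x)) (px , refl))
            (witness⇒1≤count (P? ∩? ∁? (_≟ x)) (py , x≢y ∘ sym)))
  (≤-reflexive (sym (count-split P? (_≟ x))))

𝟙≤count : {A : Set p} {Q : Pred (Fin n) q} (d : Dec A) (Q? : Decidable Q) → (A → ∃ Q) → 𝟙 d ≤ count Q?
𝟙≤count (yes a) Q? witness = witness⇒1≤count Q? (proj₂ (witness a))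
𝟙≤count (no _)  Q? witness = z≤n

∑-count-fibres : {Q : Pred (Fin m) q} (Q? : Decidable Q) (f : Fin m → Fin n) →
                 ∑[ x < n ] count (Q? ∩? λ y → f y ≟ x) ≡ count Q?
∑-count-fibres {n = n} Q? f =
  trans (∑-comm (λ x y → 𝟙 ((Q? ∩? λ y → f y ≟ x) y))) (sum-cong-≗ fibre)
  where
  fibre : ∀ y → ∑[ x < n ] 𝟙 (Q? y ×-dec f y ≟ x) ≡ 𝟙 (Q? y)
  fibre y with Q? y
  ... | yes _ = ∑-δ (f y)
  ... | no _  = sum-replicate-zero n

∑-fibres : (f : Fin m → Fin n) → ∑[ x < n ] count (λ y → f y ≟ x) ≡ m
∑-fibres {m = m} f = trans (∑-count-fibres U? f) (trans (∑-const m 1) (*-identityʳ m))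

count-≤-image : {P : Pred (Fin n) p} {Q : Pred (Fin m) q} (P? : Decidable P) (Q? : Decidable Q)
                (f : Fin m → Fin n) → (∀ {x} → P x → ∃ λ y → Q y × f y ≡ x) → count P? ≤ count Q?
count-≤-image P? Q? f covered = ≤-trans
  (∑-mono-≤ (λ x → 𝟙≤count (P? x) (Q? ∩? λ y → f y ≟ x) covered))
  (≤-reflexive (∑-count-fibres Q? f))

𝟙[≢1]≤pred : ∀ {m} → 1 ≤ m → 𝟙 (¬? (m ℕ.≟ 1)) ≤ pred m
𝟙[≢1]≤pred {suc zero}    _ = z≤n
𝟙[≢1]≤pred {suc (suc m)} _ = s≤s z≤n

module _ {n : ℕ} where

  ∑ⱽ : ∀ k → (Vec (Fin n) k → ℕ) → ℕ
  ∑ⱽ zero    f = f []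
  ∑ⱽ (suc k) f = ∑ⱽ k (λ S → ∑[ s < n ] f (s ∷ S))

  ∑ⱽ-mono-≤ : ∀ k {f g : Vec (Fin n) k → ℕ} → (∀ S → f S ≤ g S) → ∑ⱽ k f ≤ ∑ⱽ k g
  ∑ⱽ-mono-≤ zero    f≤g = f≤g []
  ∑ⱽ-mono-≤ (suc k) f≤g = ∑ⱽ-mono-≤ k (λ S → ∑-mono-≤ (λ s → f≤g (s ∷ S)))

  ∑ⱽ-cong : ∀ k {f g : Vec (Fin n) k → ℕ} → (∀ S → f S ≡ g S) → ∑ⱽ k f ≡ ∑ⱽ k g
  ∑ⱽ-cong k f≡g = ≤-antisym (∑ⱽ-mono-≤ k (≤-reflexive ∘ f≡g)) (∑ⱽ-mono-≤ k (≤-reflexive ∘ sym ∘ f≡g))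

  ∑ⱽ-distrib-+ : ∀ k (f g : Vec (Fin n) k → ℕ) → ∑ⱽ k (λ S → f S + g S) ≡ ∑ⱽ k f + ∑ⱽ k g
  ∑ⱽ-distrib-+ zero    f g = refl
  ∑ⱽ-distrib-+ (suc k) f g = trans
    (∑ⱽ-cong k (λ S → ∑-distrib-+ (λ s → f (s ∷ S)) (λ s → g (s ∷ S))))
    (∑ⱽ-distrib-+ k _ _)

  *-distribˡ-∑ⱽ : ∀ k c (f : Vec (Fin n) k → ℕ) → c * ∑ⱽ k f ≡ ∑ⱽ k (λ S → c * f S)
  *-distribˡ-∑ⱽ zero    c f = refl
  *-distribˡ-∑ⱽ (suc k) c f = trans
    (*-distribˡ-∑ⱽ k c _)
    (∑ⱽ-cong k (λ S → *-distribˡ-sum c (λ s → f (s ∷ S))))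

  ∑ⱽ-const : ∀ k c → ∑ⱽ k (λ _ → c) ≡ n ^ k * c
  ∑ⱽ-const zero    c = sym (*-identityˡ c)
  ∑ⱽ-const (suc k) c = begin
    ∑ⱽ k (λ _ → ∑[ s < n ] c) ≡⟨ ∑ⱽ-cong k (λ _ → ∑-const n c) ⟩
    ∑ⱽ k (λ _ → n * c)         ≡⟨ ∑ⱽ-const k (n * c) ⟩
    n ^ k * (n * c)            ≡⟨ *-assoc (n ^ k) n c ⟨
    n ^ k * n * c              ≡⟨ cong (_* c) (*-comm (n ^ k) n) ⟩
    n ^ suc k * c              ∎
    where open ≡-Reasoning

  ∑ⱽ-halving : (f : ∀ {k} → Vec (Fin n) k → ℕ) →
               (∀ {k} (S : Vec (Fin n) k) → 2 * ∑[ s < n ] f (s ∷ S) ≤ n * f S) →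
               ∀ k → 2 ^ k * ∑ⱽ k f ≤ n ^ k * f []
  ∑ⱽ-halving f halves zero    = ≤-refl
  ∑ⱽ-halving f halves (suc k) = begin
    2 ^ suc k * ∑ⱽ k f′                 ≡⟨ xy∙z≈y∙xz 2 (2 ^ k) _ ⟩
    2 ^ k * (2 * ∑ⱽ k f′)               ≡⟨ cong (2 ^ k *_) (*-distribˡ-∑ⱽ k 2 f′) ⟩
    2 ^ k * ∑ⱽ k (λ S → 2 * f′ S)       ≤⟨ *-monoʳ-≤ (2 ^ k) (∑ⱽ-mono-≤ k halves) ⟩
    2 ^ k * ∑ⱽ k (λ S → n * f S)        ≡⟨ cong (2 ^ k *_) (*-distribˡ-∑ⱽ k n f) ⟨
    2 ^ k * (n * ∑ⱽ k f)                ≡⟨ x∙yz≈y∙xz (2 ^ k) n _ ⟩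
    n * (2 ^ k * ∑ⱽ k f)                ≤⟨ *-monoʳ-≤ n (∑ⱽ-halving f halves k) ⟩
    n * (n ^ k * f [])                  ≡⟨ *-assoc n (n ^ k) (f []) ⟨
    n ^ suc k * f []                    ∎
    where
    open ≤-Reasoning
    f′ : Vec (Fin n) k → ℕ
    f′ S = ∑[ s < n ] f (s ∷ S)

  vectors : ∀ k → List (Vec (Fin n) k)
  vectors zero    = [ [] ]
  vectors (suc k) = cartesianProductWith (λ S s → s ∷ S) (vectors k) (allFin n)

  vectors-unique : ∀ k → Unique (vectors k)
  vectors-unique zero    = All.[] ∷ []
  vectors-unique (suc k) = cartesianProductWith⁺ _ (λ { refl → refl , refl }) (vectors-unique k) (allFin⁺ n)

length-filter≡sum𝟙 : {P : Pred A p} (P? : Decidable P) (xs : List A) → length (filter P? xs) ≡ sumˡ (map (𝟙 ∘ P?) xs)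
length-filter≡sum𝟙 P? []       = refl
length-filter≡sum𝟙 P? (x ∷ xs) with P? x
... | yes _ = cong suc (length-filter≡sum𝟙 P? xs)
... | no _  = length-filter≡sum𝟙 P? xs

sum-map-tabulate : ∀ {m} (f : A → ℕ) (g : Fin m → A) → sumˡ (map f (tabulate g)) ≡ ∑[ i < m ] f (g i)
sum-map-tabulate {m = zero}  f g = refl
sum-map-tabulate {m = suc m} f g = cong (f (g Fin.zero) +_) (sum-map-tabulate f (g ∘ Fin.suc))

sum-map-cartesianProductWith : (f : C → ℕ) (g : A → B → C) (xs : List A) (ys : List B) →
  sumˡ (map f (cartesianProductWith g xs ys)) ≡ sumˡ (map (λ x → sumˡ (map (f ∘ g x) ys)) xs)
sum-map-cartesianProductWith f g []       ys = refl
sum-map-cartesianProductWith f g (x ∷ xs) ys = begin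
  sumˡ (map f (map (g x) ys ++ cartesianProductWith g xs ys))
    ≡⟨ cong sumˡ (map-++ f (map (g x) ys) _) ⟩
  sumˡ (map f (map (g x) ys) ++ map f (cartesianProductWith g xs ys))
    ≡⟨ sum-++ (map f (map (g x) ys)) _ ⟩
  sumˡ (map f (map (g x) ys)) + sumˡ (map f (cartesianProductWith g xs ys))
    ≡⟨ cong₂ _+_ (cong sumˡ (sym (map-∘ ys))) (sum-map-cartesianProductWith f g xs ys) ⟩
  sumˡ (map (f ∘ g x) ys) + sumˡ (map (λ x → sumˡ (map (f ∘ g x) ys)) xs) ∎
  where open ≡-Reasoning

sum-map-vectors : ∀ {n} k (f : Vec (Fin n) k → ℕ) → sumˡ (map f (vectors k)) ≡ ∑ⱽ k f
sum-map-vectors zero    f = +-identityʳ (f [])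
sum-map-vectors {n} (suc k) f = begin
  sumˡ (map f (vectors (suc k)))
    ≡⟨ sum-map-cartesianProductWith f (λ S s → s ∷ S) (vectors k) (allFin n) ⟩
  sumˡ (map (λ S → sumˡ (map (λ s → f (s ∷ S)) (allFin n))) (vectors k))
    ≡⟨ cong sumˡ (map-cong (λ S → sum-map-tabulate (λ s → f (s ∷ S)) id) (vectors k)) ⟩
  sumˡ (map (λ S → ∑[ s < n ] f (s ∷ S)) (vectors k))
    ≡⟨ sum-map-vectors k (λ S → ∑[ s < n ] f (s ∷ S)) ⟩
  ∑ⱽ (suc k) f
    ∎
  where open ≡-Reasoning

Idempotent : (Fin n → Fin n) → Set
Idempotent r = ∀ x → r (r x) ≡ r x

redirect : Fin n → Fin n → Fin n → Fin n
redirect u v w with w ≟ u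
... | yes _ = v
... | no _  = w

redirect-source : (u v : Fin n) → redirect u v u ≡ v
redirect-source u v with u ≟ u
... | yes _  = refl
... | no u≢u = contradiction refl u≢u

redirect-target : (u v : Fin n) → redirect u v v ≡ v
redirect-target u v with v ≟ u
... | yes _ = refl
... | no _  = refl

redirect-idempotent : (u v w : Fin n) → redirect u v (redirect u v w) ≡ redirect u v w
redirect-idempotent u v w with w ≟ u
... | yes _ = redirect-target u v
... | no w≢u with w ≟ u
...   | yes w≡u = contradiction w≡u w≢u
...   | no _    = refl

-- Merges the class of b into that of a, where r maps each point to the root of its class.
join : (Fin n → Fin n) → Fin n → Fin n → Fin n → Fin n
join r a b x = redirect (r b) (r a) (r x)

module _ {r : Fin n → Fin n} (r-idem : Idempotent r) (a b : Fin n) where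

  join-roots : ∀ x → r (join r a b x) ≡ join r a b x
  join-roots x with r x ≟ r b
  ... | yes _ = r-idem a
  ... | no _  = r-idem x

  join-idempotent : Idempotent (join r a b)
  join-idempotent x = trans (cong (redirect (r b) (r a)) (join-roots x)) (redirect-idempotent (r b) (r a) (r x))

join-coarsens : (r : Fin n → Fin n) (a b : Fin n) {x y : Fin n} → r x ≡ r y → join r a b x ≡ join r a b y
join-coarsens r a b = cong (redirect (r b) (r a))

join-unites : (r : Fin n → Fin n) (a b : Fin n) → join r a b a ≡ join r a b b
join-unites r a b = trans (redirect-target (r b) (r a)) (sym (redirect-source (r b) (r a)))

join-related : {_∼_ : Rel (Fin n) ℓ} → IsEquivalence _∼_ → (r : Fin n → Fin n) →
               (∀ x → x ∼ r x) → {a b : Fin n} → a ∼ b → ∀ x → x ∼ join r a b x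
join-related {_∼_ = _∼_} ∼-equiv r x∼rx {a} {b} a∼b x with r x ≟ r b
... | yes rx≡rb = ∼-trans (subst (x ∼_) rx≡rb (x∼rx x)) (∼-trans (∼-sym (x∼rx b)) (∼-trans (∼-sym a∼b) (x∼rx a)))
  where open IsEquivalence ∼-equiv renaming (sym to ∼-sym; trans to ∼-trans)
... | no _ = x∼rx x

joinEdges : (Fin n → Fin n) → List (Fin n) → (Fin n → Fin n) → Fin n → Fin n
joinEdges f []       r = r
joinEdges f (a ∷ as) r = joinEdges f as (join r a (f a))

module _ (f : Fin n → Fin n) where

  joinEdges-idempotent : ∀ as {r} → Idempotent r → Idempotent (joinEdges f as r)
  joinEdges-idempotent []       r-idem = r-idem
  joinEdges-idempotent (a ∷ as) r-idem = joinEdges-idempotent as (join-idempotent r-idem a (f a))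

  joinEdges-roots : ∀ as {r} → Idempotent r → ∀ x → r (joinEdges f as r x) ≡ joinEdges f as r x
  joinEdges-roots []       r-idem x = r-idem x
  joinEdges-roots (a ∷ as) {r} r-idem x = begin
    r (R x)       ≡⟨ cong r (joinEdges-roots as r′-idem x) ⟨
    r (r′ (R x))  ≡⟨ join-roots r-idem a (f a) (R x) ⟩
    r′ (R x)      ≡⟨ joinEdges-roots as r′-idem x ⟩
    R x           ∎
    where
    open ≡-Reasoning
    r′ R : Fin n → Fin n
    r′ = join r a (f a)
    R  = joinEdges f as r′
    r′-idem : Idempotent r′
    r′-idem = join-idempotent r-idem a (f a)

  joinEdges-coarsens : ∀ as r {x y} → r x ≡ r y → joinEdges f as r x ≡ joinEdges f as r y
  joinEdges-coarsens []       r rx≡ry = rx≡ry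
  joinEdges-coarsens (a ∷ as) r rx≡ry = joinEdges-coarsens as _ (join-coarsens r a (f a) rx≡ry)

  joinEdges-unites : ∀ as r {a} → a ∈ as → joinEdges f as r a ≡ joinEdges f as r (f a)
  joinEdges-unites (a ∷ as) r (here refl)  = joinEdges-coarsens as _ (join-unites r a (f a))
  joinEdges-unites (_ ∷ as) r (there a∈as) = joinEdges-unites as _ a∈as

  joinEdges-related : {_∼_ : Rel (Fin n) ℓ} → IsEquivalence _∼_ → (∀ a → a ∼ f a) →
                      ∀ as r → (∀ x → x ∼ r x) → ∀ x → x ∼ joinEdges f as r x
  joinEdges-related ∼-equiv a∼fa []       r x∼rx = x∼rx
  joinEdges-related ∼-equiv a∼fa (a ∷ as) r x∼rx =
    joinEdges-related ∼-equiv a∼fa as _ (join-related ∼-equiv r x∼rx (a∼fa a))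

module _ {n : ℕ} (L : LatinSquare n) where

  column : Fin n → Fin n → Fin n
  column s i = proj₁ (proj₂ (rowBij L i) s)

  entry-column : ∀ s i → entry L i (column s i) ≡ s
  entry-column s i = proj₂ (proj₂ (rowBij L i) s) refl

  module _ {k} {S : Vec (Fin n) k} where

    Adj-sym : ∀ {i j} → Adj L S i j → Adj L S j i
    Adj-sym (i≢j , inj₁ ij∈S) = i≢j ∘ sym , inj₂ ij∈S
    Adj-sym (i≢j , inj₂ ji∈S) = i≢j ∘ sym , inj₁ ji∈S

    Reach-trans : ∀ {i j l} → Reach L S i j → Reach L S j l → Reach L S i l
    Reach-trans w here        = w
    Reach-trans w (step v jl) = step (Reach-trans w v) jl

    Reach-sym : ∀ {i j} → Reach L S i j → Reach L S j i
    Reach-sym here        = here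
    Reach-sym (step w jl) = Reach-trans (step here (Adj-sym jl)) (Reach-sym w)

    Reach-isEquivalence : IsEquivalence (Reach L S)
    Reach-isEquivalence = record
      { refl = here ; sym = Reach-sym ; trans = Reach-trans }

    Reach-∷ : ∀ {s i j} → Reach L S i j → Reach L (s ∷ S) i j
    Reach-∷ here                              = here
    Reach-∷ (step w (j≢l , inj₁ (t , jl≡))) = step (Reach-∷ w) (j≢l , inj₁ (Fin.suc t , jl≡))
    Reach-∷ (step w (j≢l , inj₂ (t , lj≡))) = step (Reach-∷ w) (j≢l , inj₂ (Fin.suc t , lj≡))

    Reach-column : ∀ s i → Reach L (s ∷ S) i (column s i)
    Reach-column s i with i ≟ column s i
    ... | yes i≡j = subst (Reach L (s ∷ S) i) i≡j here
    ... | no  i≢j = step here (i≢j , inj₁ (Fin.zero , sym (entry-column s i)))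

  -- rep S maps each vertex to the root of its component in G(L, S).
  rep : ∀ {k} → Vec (Fin n) k → Fin n → Fin n
  rep []      = id
  rep (s ∷ S) = joinEdges (column s) (allFin n) (rep S)

  rep-idempotent : ∀ {k} (S : Vec (Fin n) k) → Idempotent (rep S)
  rep-idempotent []      x = refl
  rep-idempotent (s ∷ S)   = joinEdges-idempotent (column s) (allFin n) (rep-idempotent S)

  rep-reach : ∀ {k} (S : Vec (Fin n) k) x → Reach L S x (rep S x)
  rep-reach []      x = here
  rep-reach (s ∷ S)   = joinEdges-related (column s) Reach-isEquivalence (Reach-column s)
                          (allFin n) (rep S) (Reach-∷ ∘ rep-reach S)

  module _ {k} (S : Vec (Fin n) k) (s : Fin n) where

    rep-∷-coarsens : ∀ {x y} → rep S x ≡ rep S y → rep (s ∷ S) x ≡ rep (s ∷ S) y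
    rep-∷-coarsens = joinEdges-coarsens (column s) (allFin n) (rep S)

    rep-∷-rep : ∀ x → rep (s ∷ S) (rep S x) ≡ rep (s ∷ S) x
    rep-∷-rep x = rep-∷-coarsens (rep-idempotent S x)

    rep-∷-column : ∀ x → rep (s ∷ S) x ≡ rep (s ∷ S) (column s x)
    rep-∷-column x = joinEdges-unites (column s) (allFin n) (rep S) (∈-allFin x)

    rep-∷-root : ∀ x → rep S (rep (s ∷ S) x) ≡ rep (s ∷ S) x
    rep-∷-root = joinEdges-roots (column s) (allFin n) (rep-idempotent S)

  IsRoot : ∀ {k} → Vec (Fin n) k → Pred (Fin n) 0ℓ
  IsRoot S z = rep S z ≡ z

  isRoot? : ∀ {k} (S : Vec (Fin n) k) → Decidable (IsRoot S)
  isRoot? S z = rep S z ≟ z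

  #roots : ∀ {k} → Vec (Fin n) k → ℕ
  #roots S = count (isRoot? S)

  #roots≡1⇒connected : ∀ {k} (S : Vec (Fin n) k) → #roots S ≡ 1 → Connected L S
  #roots≡1⇒connected S one-root i j with rep S i ≟ rep S j
  ... | yes ri≡rj = Reach-trans (rep-reach S i) (subst (λ r → Reach L S r j) (sym ri≡rj) (Reach-sym (rep-reach S j)))
  ... | no  ri≢rj = contradiction (distinct⇒2≤count (isRoot? S) (rep-idempotent S i) (rep-idempotent S j) ri≢rj)
                                  (<⇒≱ (≤-reflexive (cong suc one-root)))

  Closed : ∀ {k} → Vec (Fin n) k → Fin n → Pred (Fin n) 0ℓ
  Closed S s z = ∀ x → rep S x ≡ z → rep S (column s x) ≡ z

  closed? : ∀ {k} (S : Vec (Fin n) k) s → Decidable (Closed S s)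
  closed? S s z = all? (λ x → (rep S x ≟ z) →-dec (rep S (column s x) ≟ z))

  #closedRoots : ∀ {k} → Vec (Fin n) k → Fin n → ℕ
  #closedRoots S s = count (isRoot? S ∩? closed? S s)

  module _ {k} (S : Vec (Fin n) k) (s : Fin n) where

    private
      S′ : Vec (Fin n) (suc k)
      S′ = s ∷ S

    IsRoot-∷⇒IsRoot : ∀ {z} → IsRoot S′ z → IsRoot S z
    IsRoot-∷⇒IsRoot {z} root′ = trans (cong (rep S) (sym root′)) (trans (rep-∷-root S s z) root′)

    -- If column s leaves the S-class of z at x, the S-root of column s x is merged into z.
    unclosed⇒lost-root : ∀ {z} → IsRoot S′ z × ¬ Closed S s z →
                         ∃ λ y → (IsRoot S y × ¬ IsRoot S′ y) × rep S′ y ≡ z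
    unclosed⇒lost-root {z} (root′ , unclosed) with ¬∀⟶∃¬ n _ (λ x → (rep S x ≟ z) →-dec (rep S (column s x) ≟ z)) unclosed
    ... | x , escapes = rep S (column s x) , (rep-idempotent S _ , lost) , y↦z
      where
      rx≡z : rep S x ≡ z
      rx≡z = decidable-stable (rep S x ≟ z) (λ rx≢z → escapes (λ rx≡z → contradiction rx≡z rx≢z))
      y↦z : rep S′ (rep S (column s x)) ≡ z
      y↦z = begin
        rep S′ (rep S (column s x)) ≡⟨ rep-∷-rep S s (column s x) ⟩
        rep S′ (column s x)         ≡⟨ rep-∷-column S s x ⟨
        rep S′ x                    ≡⟨ rep-∷-coarsens S s (trans rx≡z (sym (IsRoot-∷⇒IsRoot root′))) ⟩
        rep S′ z                    ≡⟨ root′ ⟩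
        z                           ∎
        where open ≡-Reasoning
      lost : ¬ IsRoot S′ (rep S (column s x))
      lost root = escapes (λ _ → trans (sym root) y↦z)

    #roots-∷ : #roots S′ + #roots S′ ≤ #roots S + #closedRoots S s
    #roots-∷ = begin
      #roots S′ + #roots S′
        ≡⟨ cong (#roots S′ +_) (count-split (isRoot? S′) (closed? S s)) ⟩
      #roots S′ + (count kept? + count merged?)
        ≤⟨ +-mono-≤ still≤ (+-mono-≤ kept≤ merged≤) ⟩
      count still? + (#closedRoots S s + count lost?)
        ≡⟨ cong (count still? +_) (+-comm (#closedRoots S s) (count lost?)) ⟩
      count still? + (count lost? + #closedRoots S s)
        ≡⟨ +-assoc (count still?) (count lost?) (#closedRoots S s) ⟨
      count still? + count lost? + #closedRoots S s
        ≡⟨ cong (_+ #closedRoots S s) (count-split (isRoot? S) (isRoot? S′)) ⟨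
      #roots S + #closedRoots S s
        ∎
      where
      open ≤-Reasoning
      kept? : Decidable (IsRoot S′ ∩ Closed S s)
      kept? = isRoot? S′ ∩? closed? S s
      merged? : Decidable (IsRoot S′ ∩ ∁ (Closed S s))
      merged? = isRoot? S′ ∩? ∁? (closed? S s)
      still? : Decidable (IsRoot S ∩ IsRoot S′)
      still? = isRoot? S ∩? isRoot? S′
      lost? : Decidable (IsRoot S ∩ ∁ (IsRoot S′))
      lost? = isRoot? S ∩? ∁? (isRoot? S′)
      still≤ : #roots S′ ≤ count still?
      still≤ = count-mono (isRoot? S′) still? (λ root′ → IsRoot-∷⇒IsRoot root′ , root′)
      kept≤ : count kept? ≤ #closedRoots S s
      kept≤ = count-mono kept? (isRoot? S ∩? closed? S s) (map₁ IsRoot-∷⇒IsRoot)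
      merged≤ : count merged? ≤ count lost?
      merged≤ = count-≤-image merged? lost? (rep S′) unclosed⇒lost-root

  -- s ↦ column s z maps the symbols closing the class of the root z injectively into that class.
  ∑-#closedRoots : ∀ {k} (S : Vec (Fin n) k) → ∑[ s < n ] #closedRoots S s ≤ n
  ∑-#closedRoots S = begin
    ∑[ s < n ] ∑[ z < n ] 𝟙 ((isRoot? S ∩? closed? S s) z) ≡⟨ ∑-comm (λ s z → 𝟙 ((isRoot? S ∩? closed? S s) z)) ⟩
    ∑[ z < n ] ∑[ s < n ] 𝟙 ((isRoot? S ∩? closed? S s) z) ≤⟨ ∑-mono-≤ closed≤class ⟩
    ∑[ z < n ] count (λ y → rep S y ≟ z)                     ≡⟨ ∑-fibres (rep S) ⟩
    n                                                         ∎
    where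
    open ≤-Reasoning
    closed≤class : ∀ z → count (λ s → (isRoot? S ∩? closed? S s) z) ≤ count (λ y → rep S y ≟ z)
    closed≤class z = count-≤-image (λ s → (isRoot? S ∩? closed? S s) z) (λ y → rep S y ≟ z) (entry L z)
      (λ {s} (root , closed) → column s z , closed z root , entry-column s z)

  ∑-#roots-∷ : ∀ {k} (S : Vec (Fin n) k) → ∑[ s < n ] #roots (s ∷ S) + ∑[ s < n ] #roots (s ∷ S) ≤ n * #roots S + n
  ∑-#roots-∷ S = begin
    ∑[ s < n ] #roots (s ∷ S) + ∑[ s < n ] #roots (s ∷ S) ≡⟨ ∑-distrib-+ (λ s → #roots (s ∷ S)) (λ s → #roots (s ∷ S)) ⟨
    ∑[ s < n ] (#roots (s ∷ S) + #roots (s ∷ S))         ≤⟨ ∑-mono-≤ (#roots-∷ S) ⟩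
    ∑[ s < n ] (#roots S + #closedRoots S s)              ≡⟨ ∑-distrib-+ (λ _ → #roots S) (#closedRoots S) ⟩
    ∑[ s < n ] #roots S + ∑[ s < n ] #closedRoots S s     ≤⟨ +-mono-≤ (≤-reflexive (∑-const n (#roots S))) (∑-#closedRoots S) ⟩
    n * #roots S + n                                      ∎
    where open ≤-Reasoning

  excess : ∀ {k} → Vec (Fin n) k → ℕ
  excess S = pred (#roots S)

  module _ (a : Fin n) where

    1≤#roots : ∀ {k} (S : Vec (Fin n) k) → 1 ≤ #roots S
    1≤#roots S = witness⇒1≤count (isRoot? S) (rep-idempotent S a)

    #roots≡suc-excess : ∀ {k} (S : Vec (Fin n) k) → #roots S ≡ suc (excess S)
    #roots≡suc-excess S = sym (suc-pred (#roots S) {{>-nonZero (1≤#roots S)}})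

    excess-∷ : ∀ {k} (S : Vec (Fin n) k) → 2 * ∑[ s < n ] excess (s ∷ S) ≤ n * excess S
    excess-∷ S = +-cancelˡ-≤ (n + n) (2 * E′) (n * excess S) (begin
      n + n + 2 * E′                                        ≡⟨ m+m+2*e≡[m+e]+[m+e] n E′ ⟩
      (n + E′) + (n + E′)                                   ≡⟨ cong₂ _+_ ∑#roots′ ∑#roots′ ⟨
      ∑[ s < n ] #roots (s ∷ S) + ∑[ s < n ] #roots (s ∷ S) ≤⟨ ∑-#roots-∷ S ⟩
      n * #roots S + n                                      ≡⟨ cong (λ r → n * r + n) (#roots≡suc-excess S) ⟩
      n * suc (excess S) + n                                ≡⟨ m*[1+e]+m≡m+m+m*e n (excess S) ⟩
      n + n + n * excess S                                  ∎)
      where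
      open ≤-Reasoning
      E′ : ℕ
      E′ = ∑[ s < n ] excess (s ∷ S)
      ∑#roots′ : ∑[ s < n ] #roots (s ∷ S) ≡ n + E′
      ∑#roots′ = begin-equality
        ∑[ s < n ] #roots (s ∷ S)       ≡⟨ sum-cong-≗ (λ s → #roots≡suc-excess (s ∷ S)) ⟩
        ∑[ s < n ] (1 + excess (s ∷ S)) ≡⟨ ∑-distrib-+ (λ _ → 1) (λ s → excess (s ∷ S)) ⟩
        ∑[ s < n ] 1 + E′               ≡⟨ cong (_+ E′) (trans (∑-const n 1) (*-identityʳ n)) ⟩
        n + E′                          ∎
      m+m+2*e≡[m+e]+[m+e] : ∀ m e → m + m + 2 * e ≡ (m + e) + (m + e)
      m+m+2*e≡[m+e]+[m+e] = solve-∀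
      m*[1+e]+m≡m+m+m*e : ∀ m e → m * suc e + m ≡ m + m + m * e
      m*[1+e]+m≡m+m+m*e = solve-∀

    bad≤excess : ∀ {k} (S : Vec (Fin n) k) → 𝟙 (¬? (#roots S ℕ.≟ 1)) ≤ excess S
    bad≤excess S = 𝟙[≢1]≤pred (1≤#roots S)

probAtLeast-connected : ∀ {n} (L : LatinSquare (suc n)) k m → suc m * suc n ≤ 2 ^ k →
                        ProbAtLeast (suc n) k m (Connected L)
probAtLeast-connected {n} L k m enough-symbols =
  filter one-root? (vectors k) ,
  filter⁺ one-root? (vectors-unique k) ,
  All.map (#roots≡1⇒connected L _) (all-filter one-root? (vectors k)) ,
  subst (λ g → m * N ^ k ≤ suc m * g) (sym length-good≡∑good)
        (complement-bound m ∑good+∑bad≡N^k (*-cancelʳ-≤ (suc m * ∑bad) (N ^ k) N ∑bad-bound))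
  where
  N : ℕ
  N = suc n
  one-root? : (S : Vec (Fin N) k) → Dec (#roots L S ≡ 1)
  one-root? S = #roots L S ℕ.≟ 1
  ∑good ∑bad : ℕ
  ∑good = ∑ⱽ k (𝟙 ∘ one-root?)
  ∑bad  = ∑ⱽ k (𝟙 ∘ ¬? ∘ one-root?)
  length-good≡∑good : length (filter one-root? (vectors k)) ≡ ∑good
  length-good≡∑good = trans (length-filter≡sum𝟙 one-root? (vectors k)) (sum-map-vectors k (𝟙 ∘ one-root?))
  ∑good+∑bad≡N^k : ∑good + ∑bad ≡ N ^ k
  ∑good+∑bad≡N^k = begin
    ∑good + ∑bad                                         ≡⟨ ∑ⱽ-distrib-+ k (𝟙 ∘ one-root?) (𝟙 ∘ ¬? ∘ one-root?) ⟨
    ∑ⱽ k (λ S → 𝟙 (one-root? S) + 𝟙 (¬? (one-root? S))) ≡⟨ ∑ⱽ-cong k (𝟙+𝟙¬ ∘ one-root?) ⟩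
    ∑ⱽ k (λ _ → 1)                                       ≡⟨ ∑ⱽ-const k 1 ⟩
    N ^ k * 1                                            ≡⟨ *-identityʳ (N ^ k) ⟩
    N ^ k                                                ∎
    where open ≡-Reasoning
  ∑bad-bound : suc m * ∑bad * N ≤ N ^ k * N
  ∑bad-bound = begin
    suc m * ∑bad * N         ≡⟨ xy∙z≈y∙xz (suc m) ∑bad N ⟩
    ∑bad * (suc m * N)       ≤⟨ *-monoʳ-≤ ∑bad enough-symbols ⟩
    ∑bad * 2 ^ k             ≡⟨ *-comm ∑bad (2 ^ k) ⟩
    2 ^ k * ∑bad             ≤⟨ *-monoʳ-≤ (2 ^ k) (∑ⱽ-mono-≤ k (bad≤excess L Fin.zero)) ⟩
    2 ^ k * ∑ⱽ k (excess L)  ≤⟨ ∑ⱽ-halving (excess L) (excess-∷ L Fin.zero) k ⟩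
    N ^ k * excess L []      ≤⟨ *-monoʳ-≤ (N ^ k) (≤-trans pred[n]≤n (count≤n (isRoot? L []))) ⟩
    N ^ k * N                ∎
    where open ≤-Reasoning

enough-symbols : ∀ p q m {n k} → 0 < p → (2 * suc m) ^ suc q ≤ n →
                 n ^ (suc q + p) < 2 ^ (suc k * suc q) → suc m * n ≤ 2 ^ k
enough-symbols (suc p) q m {n} {k} _ large-n few-symbols = ≮⇒≥ λ 2^k<mn → <⇒≱ few-symbols (begin
  2 ^ (suc k * suc q)                 ≡⟨ ^-*-assoc 2 (suc k) (suc q) ⟨
  (2 * 2 ^ k) ^ suc q                 ≤⟨ ^-monoˡ-≤ (suc q) (*-monoʳ-≤ 2 (<⇒≤ 2^k<mn)) ⟩
  (2 * (suc m * n)) ^ suc q           ≡⟨ cong (_^ suc q) (*-assoc 2 (suc m) n) ⟨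
  (2 * suc m * n) ^ suc q             ≡⟨ ^-distrib-* (2 * suc m) n (suc q) ⟩
  (2 * suc m) ^ suc q * n ^ suc q     ≤⟨ *-monoˡ-≤ (n ^ suc q) (≤-trans large-n (m≤m^[1+n] n p)) ⟩
  n ^ suc p * n ^ suc q               ≡⟨ *-comm (n ^ suc p) (n ^ suc q) ⟩
  n ^ suc q * n ^ suc p               ≡⟨ ^-distribˡ-+-* n (suc q) (suc p) ⟨
  n ^ (suc q + suc p)                 ∎)
  where open ≤-Reasoning

theorem2p12 : (p q : ℕ) → 0 < p →
    (L : (n : ℕ) → LatinSquare n) →
    (m : ℕ) → ∃ λ N → ∀ n → N ≤ n → ∀ k →
    2 ^ (k * suc q) ≤ n ^ (suc q + p) →
    n ^ (suc q + p) < 2 ^ (suc k * suc q) →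
    ProbAtLeast n k m (Connected (L n))
theorem2p12 p q 0<p L m = (2 * suc m) ^ suc q , large-n⇒connected
  where
  large-n⇒connected : ∀ n → (2 * suc m) ^ suc q ≤ n → ∀ k →
                      2 ^ (k * suc q) ≤ n ^ (suc q + p) → n ^ (suc q + p) < 2 ^ (suc k * suc q) →
                      ProbAtLeast n k m (Connected (L n))
  large-n⇒connected zero    large-n = contradiction (≤-trans (m^n>0 (2 * suc m) (suc q)) large-n) λ ()
  large-n⇒connected (suc n) large-n k _ few-symbols =
    probAtLeast-connected (L (suc n)) k m (enough-symbols p q m {k = k} 0<p large-n few-symbols)
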